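{- Let $\mathcal M=\langle(\mathcal C_i)_{i\in I},(\mathcal B_i)_{i\in I},(R_j)_{j\in J}\rangle$ be a model and $\mathcal I$ an $\mathcal M$-interpretation. Let $\Gamma=\{x_k:A_k\}_{1\le k\le n}$ and $\Delta=\{\alpha_r:B_r\}_{1\le r\le m}$ be such that $\alpha_r\in\mathcal C_{w(\mathcal I(B_r))}$ for $1\le r\le m$. Let $u_k\in\mathcal I(A_k)$ ($1\le k\le n$), $\bar v_r\in(\mathcal I(B_r))^\perp$ ($1\le r\le m$), and $\sigma=[(x_k:=u_k)_{1\le k\le n};(\alpha_r:=^*\bar v_r)_{1\le r\le m}]$. If $\Gamma\vdash u:A;\Delta$, then $u\sigma\in\mathcal I(A)$.
   Context: $\lambda\mu$-terms over disjoint infinite sets of $\lambda$-variables and $\mu$-variables: $t ::= x \mid \lambda x.t \mid (t\,t) \mid \mu\alpha.t \mid (\alpha\,t)$. $u[\alpha:=^*v]$ replaces inductively each subterm $(\alpha\,w)$ of $u$ by $(\alpha\,(w\,v))$. Reduction $\triangleright$: compatible closure of $(\lambda x.u\;v)\triangleright u[x:=v]$ and $(\mu\alpha.u\;v)\triangleright\mu\alpha.u[\alpha:=^*v]$; $\triangleright^*$ its reflexive transitive closure. For a finite sequence $\bar u=u_1\dots u_n$, $(t\,\bar u)=(\dots(t\,u_1)\dots u_n)$, $(t\,\emptyset)=t$; $\mathcal T$ = set of terms, $\mathcal T^{<\omega}$ = set of finite sequences of terms. Simultaneous substitution: for terms $u_k$ and finite sequences $\bar v_r$, $t\sigma$ for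 $\sigma=[(x_k:=u_k)_k;(\alpha_r:=^*\bar v_r)_r]$ is defined by induction on $t$: $x\sigma=x$ if $x\ne x_k$; $x_k\sigma=u_k$; $(\lambda x.u)\sigma=\lambda x.u\sigma$ and $(\mu\alpha.u)\sigma=\mu\alpha.u\sigma$ (bound variables chosen fresh); $(u\,v)\sigma=(u\sigma\,v\sigma)$; $(\alpha\,u)\sigma=(\alpha\,u\sigma)$ if $\alpha\neq\alpha_r$; $(\alpha_r\,u)\sigma=(\alpha_r\,(u\sigma\,\bar v_r))$. Types: $A ::= X\mid\perp\mid A\to A$ ($X$ in a set $\mathcal P$ of propositional variables). Typing rules: (ax) $\Gamma\vdash x:A;\Delta$ if $x:A\in\Gamma$; ($\to_i$) from $\Gamma,x:A\vdash t:B;\Delta$ infer $\Gamma\vdash\lambda x.t:A\to B;\Delta$; ($\to_e$) from $\Gamma\vdash u:A\to B;\Delta$ and $\Gamma\vdash v:A;\Delta$ infer $\Gamma\vdash(u\,v):B;\Delta$; ($\mu$) from $\Gamma\vdash t:\perp;\Delta,\alpha:A$ infer $\Gamma\vdash\mu\alpha.t:A;\Delta$; ($\perp$) from $\Gamma\vdash t:A;\Delta,\alpha:A$ infer $\Gamma\vdash(\alpha\,t):\perp;\Delta,\alpha:A$. Semantics: $\mathcal S$ saturated if $v\triangleright^*u$, $u\in\mathcal S$ imply $v\in\mathcal S$. $\mathcal K\leadsto\mathcal L=\{t\mid\forall u\in\mathcal K,(t\,u)\in\mathcal L\}$; for $\mathcal X\subseteq\mathcal T^{<\omega}$, $\mathcal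 X\leadsto\mathcal L=\{t\mid\forall\bar u\in\mathcal X,(t\,\bar u)\in\mathcal L\}$. A model $\mathcal M=\langle(\mathcal C_i)_{i\in I},(\mathcal B_i)_{i\in I},(R_j)_{j\in J}\rangle$: $I,J\subseteq\mathbb N$, $0\in I$, $\mathcal C_i$ pairwise disjoint infinite sets of $\mu$-variables, $\mathcal B_i,R_j$ non-empty saturated sets of terms, with: for all $i\in I$, if $\alpha\in\mathcal C_i$, $u\in\mathcal B_0$ then $\mu\alpha.u\in\mathcal B_i$; if $\alpha\in\mathcal C_i$, $u\in\mathcal B_i$ then $(\alpha\,u)\in\mathcal B_0$; for each $j\in J$ there are $i\in I$, $\mathcal X_j\subseteq\mathcal T^{<\omega}$ with $R_j=\mathcal X_j\leadsto\mathcal B_i$. $|\mathcal M|$: smallest set containing all $\mathcal B_i,R_j$ closed under $\leadsto$. Every $\mathcal G\in|\mathcal M|$ is of the form $\mathcal X\leadsto\mathcal B_i$ for some $\mathcal X\subseteq\mathcal T^{<\omega}$ and $i\in I$; $w(\mathcal G)$ is the smallest such $i$, and $\mathcal G^\perp=\bigcup\{\mathcal X\subseteq\mathcal T^{<\omega}\mid\mathcal G=\mathcal X\leadsto\mathcal B_{w(\mathcal G)}\}$. An $\mathcal M$-interpretation is $\mathcal I:\mathcal P\to|\mathcal M|$ extended by $\mathcal I(\perp)=\mathcal B_0$, $\mathcal I(A\to B)=\mathcal I(A)\leadsto\mathcal I(B)$. -}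

module Defs where

open import Level using (0ℓ) renaming (suc to lsuc)
open import Data.Nat using (ℕ; zero; suc; _≤_) renaming (_≟_ to _≟ℕ_)
open import Data.Fin using (Fin; fromℕ; inject₁) renaming (zero to fz; suc to fs; _≟_ to _≟F_)
open import Data.List using (List; []; _∷_; map; foldl)
open import Data.List.Membership.Propositional using (_∈_; _∉_)
open import Data.Maybe using (Maybe; just; nothing)
open import Data.Product using (Σ; ∃; _×_; _,_; proj₁)
open import Data.Empty using (⊥)
open import Relation.Nullary using (yes; no)
open import Relation.Binary.PropositionalEquality using (_≡_; _≢_)
open import Relation.Binary.Construct.Closure.ReflexiveTransitive using (Star)
open import Relation.Unary using (Pred; _≐_)

-- λμ-terms, locally nameless / well-scoped:
--   free λ-variables and free μ-variables are names (ℕ; the two sorts are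
--   kept apart by using different constructors), bound variables are
--   de Bruijn indices (zero = innermost binder), Tm n m has n bound
--   λ-variables and m bound μ-variables in scope.
--   Term = Tm 0 0 = the λμ-terms (taken up to α-equivalence).

data Tm (n m : ℕ) : Set where
  fvar : ℕ → Tm n m
  bvar : Fin n → Tm n m
  lam  : Tm (suc n) m → Tm n m
  app  : Tm n m → Tm n m → Tm n m
  mu   : Tm n (suc m) → Tm n m
  fnm  : ℕ → Tm n m → Tm n m         -- (α t), α a free μ-variable
  bnm  : Fin m → Tm n m → Tm n m     -- (α t), α a bound μ-variable

Term : Set
Term = Tm 0 0

apps : ∀ {n m} → Tm n m → List (Tm n m) → Tm n m
apps t us = foldl app t us

extF : ∀ {n n'} → (Fin n → Fin n') → Fin (suc n) → Fin (suc n')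
extF ρ fz = fz
extF ρ (fs i) = fs (ρ i)

renλ : ∀ {n n' m} → (Fin n → Fin n') → Tm n m → Tm n' m
renλ ρ (fvar x) = fvar x
renλ ρ (bvar i) = bvar (ρ i)
renλ ρ (lam t) = lam (renλ (extF ρ) t)
renλ ρ (app t u) = app (renλ ρ t) (renλ ρ u)
renλ ρ (mu t) = mu (renλ ρ t)
renλ ρ (fnm α t) = fnm α (renλ ρ t)
renλ ρ (bnm a t) = bnm a (renλ ρ t)

renμ : ∀ {n m m'} → (Fin m → Fin m') → Tm n m → Tm n m'
renμ ρ (fvar x) = fvar x
renμ ρ (bvar i) = bvar i
renμ ρ (lam t) = lam (renμ ρ t)
renμ ρ (app t u) = app (renμ ρ t) (renμ ρ u)
renμ ρ (mu t) = mu (renμ (extF ρ) t)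
renμ ρ (fnm α t) = fnm α (renμ ρ t)
renμ ρ (bnm a t) = bnm (ρ a) (renμ ρ t)

extsλ : ∀ {n n' m} → (Fin n → Tm n' m) → Fin (suc n) → Tm (suc n') m
extsλ s fz = bvar fz
extsλ s (fs i) = renλ fs (s i)

substλ : ∀ {n n' m} → (Fin n → Tm n' m) → Tm n m → Tm n' m
substλ s (fvar x) = fvar x
substλ s (bvar i) = s i
substλ s (lam t) = lam (substλ (extsλ s) t)
substλ s (app t u) = app (substλ s t) (substλ s u)
substλ s (mu t) = mu (substλ (λ i → renμ fs (s i)) t)
substλ s (fnm α t) = fnm α (substλ s t)
substλ s (bnm a t) = bnm a (substλ s t)

inst : ∀ {n m} → Tm (suc n) m → Tm n m → Tm n m
inst u v = substλ (λ { fz → v ; (fs i) → bvar i }) u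

stμ : ∀ {n m} → Fin m → Tm n m → Tm n m → Tm n m
stμ a v (fvar x) = fvar x
stμ a v (bvar i) = bvar i
stμ a v (lam t) = lam (stμ a (renλ fs v) t)
stμ a v (app t u) = app (stμ a v t) (stμ a v u)
stμ a v (mu t) = mu (stμ (fs a) (renμ fs v) t)
stμ a v (fnm α t) = fnm α (stμ a v t)
stμ a v (bnm b t) with a ≟F b
... | yes _ = bnm b (app (stμ a v t) v)
... | no _  = bnm b (stμ a v t)

infix 4 _▷_
data _▷_ {n m : ℕ} : Tm n m → Tm n m → Set where
  β    : ∀ u v → app (lam u) v ▷ inst u v
  μred : ∀ u v → app (mu u) v ▷ mu (stμ fz (renμ fs v) u)
  c-lam  : ∀ {t t'} → t ▷ t' → lam t ▷ lam t'
  c-appl : ∀ {t t' u} → t ▷ t' → app t u ▷ app t' u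
  c-appr : ∀ {t u u'} → u ▷ u' → app t u ▷ app t u'
  c-mu   : ∀ {t t'} → t ▷ t' → mu t ▷ mu t'
  c-fnm  : ∀ {α t t'} → t ▷ t' → fnm α t ▷ fnm α t'
  c-bnm  : ∀ {a t t'} → t ▷ t' → bnm a t ▷ bnm a t'

infix 4 _▷*_
_▷*_ : ∀ {n m} → Tm n m → Tm n m → Set
_▷*_ = Star _▷_

closeλAt : ∀ {n m} → ℕ → Tm n m → Tm (suc n) m
closeλAt x (fvar y) with x ≟ℕ y
... | yes _ = bvar (fromℕ _)
... | no _  = fvar y
closeλAt x (bvar i) = bvar (inject₁ i)
closeλAt x (lam t) = lam (closeλAt x t)
closeλAt x (app t u) = app (closeλAt x t) (closeλAt x u)
closeλAt x (mu t) = mu (closeλAt x t)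
closeλAt x (fnm α t) = fnm α (closeλAt x t)
closeλAt x (bnm a t) = bnm a (closeλAt x t)

closeμAt : ∀ {n m} → ℕ → Tm n m → Tm n (suc m)
closeμAt α (fvar y) = fvar y
closeμAt α (bvar i) = bvar i
closeμAt α (lam t) = lam (closeμAt α t)
closeμAt α (app t u) = app (closeμAt α t) (closeμAt α u)
closeμAt α (mu t) = mu (closeμAt α t)
closeμAt α (fnm γ t) with α ≟ℕ γ
... | yes _ = bnm (fromℕ _) (closeμAt α t)
... | no _  = fnm γ (closeμAt α t)
closeμAt α (bnm a t) = bnm (inject₁ a) (closeμAt α t)

Lam : ℕ → Term → Term
Lam x t = lam (closeλAt x t)

Mu : ℕ → Term → Term
Mu α t = mu (closeμAt α t)

record Sub : Set where
  field
    λpart : List (ℕ × Term)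
    μpart : List (ℕ × List Term)

lookupL : ∀ {A : Set} → List (ℕ × A) → ℕ → Maybe A
lookupL [] x = nothing
lookupL ((y , a) ∷ l) x with x ≟ℕ y
... | yes _ = just a
... | no _  = lookupL l x

-- embedding terms (no bound variables) under binders
wk0 : ∀ {n m} → Term → Tm n m
wk0 t = renμ (λ ()) (renλ (λ ()) t)

subAt : ∀ {n m} → Sub → Tm n m → Tm n m
subAt σ (fvar x) with lookupL (Sub.λpart σ) x
... | just u  = wk0 u
... | nothing = fvar x
subAt σ (bvar i) = bvar i
subAt σ (lam t) = lam (subAt σ t)
subAt σ (app t u) = app (subAt σ t) (subAt σ u)
subAt σ (mu t) = mu (subAt σ t)
subAt σ (fnm α t) with lookupL (Sub.μpart σ) α
... | just vs = fnm α (apps (subAt σ t) (map wk0 vs))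
... | nothing = fnm α (subAt σ t)
subAt σ (bnm a t) = bnm a (subAt σ t)

_⟨_⟩ : Term → Sub → Term
t ⟨ σ ⟩ = subAt σ t

infixr 7 _⇒_
data Ty : Set where
  var : ℕ → Ty
  ⊥'  : Ty
  _⇒_ : Ty → Ty → Ty

Ctx : Set
Ctx = List (ℕ × Ty)

dom : Ctx → List ℕ
dom = map proj₁

infix 3 _⊢_∶_∣_
data _⊢_∶_∣_ (Γ : Ctx) : Term → Ty → Ctx → Set where
  ax   : ∀ {x A Δ} → (x , A) ∈ Γ → Γ ⊢ fvar x ∶ A ∣ Δ
  →i   : ∀ {x A B t Δ} → x ∉ dom Γ → ((x , A) ∷ Γ) ⊢ t ∶ B ∣ Δ →
         Γ ⊢ Lam x t ∶ A ⇒ B ∣ Δ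
  →e   : ∀ {u v A B Δ} → Γ ⊢ u ∶ A ⇒ B ∣ Δ → Γ ⊢ v ∶ A ∣ Δ →
         Γ ⊢ app u v ∶ B ∣ Δ
  μi   : ∀ {α A t Δ} → α ∉ dom Δ → Γ ⊢ t ∶ ⊥' ∣ ((α , A) ∷ Δ) →
         Γ ⊢ Mu α t ∶ A ∣ Δ
  ⊥i   : ∀ {α A t Δ} → (α , A) ∈ Δ → Γ ⊢ t ∶ A ∣ Δ →
         Γ ⊢ fnm α t ∶ ⊥' ∣ Δ

Saturated : Pred Term 0ℓ → Set
Saturated S = ∀ v u → v ▷* u → S u → S v

NonEmpty : Pred Term 0ℓ → Set
NonEmpty S = ∃ λ t → S t

-- an infinite set of names (constructive reading: unbounded)
Infinite : Pred ℕ 0ℓ → Set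
Infinite C = ∀ k → ∃ λ α → k ≤ α × C α

infixr 5 _⇝_ _⇝ₛ_
_⇝_ : Pred Term 0ℓ → Pred Term 0ℓ → Pred Term 0ℓ
(K ⇝ L) t = ∀ u → K u → L (app t u)

_⇝ₛ_ : Pred (List Term) 0ℓ → Pred Term 0ℓ → Pred Term 0ℓ
(X ⇝ₛ L) t = ∀ us → X us → L (apps t us)

record Model : Set₁ where
  field
    I J : Pred ℕ 0ℓ
    0∈I : I 0
    C : ℕ → Pred ℕ 0ℓ
    C-disjoint : ∀ i j → I i → I j → i ≢ j → ∀ α → C i α → C j α → ⊥
    C-infinite : ∀ i → I i → Infinite (C i)
    B : ℕ → Pred Term 0ℓ
    R : ℕ → Pred Term 0ℓ
    B-nonempty : ∀ i → I i → NonEmpty (B i)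
    B-saturated : ∀ i → I i → Saturated (B i)
    R-nonempty : ∀ j → J j → NonEmpty (R j)
    R-saturated : ∀ j → J j → Saturated (R j)
    mu-B : ∀ i → I i → ∀ α → C i α → ∀ u → B 0 u → B i (Mu α u)
    name-B : ∀ i → I i → ∀ α → C i α → ∀ u → B i u → B 0 (fnm α u)
    R-form : ∀ j → J j → Σ ℕ λ i → I i × Σ (Pred (List Term) 0ℓ) λ X → R j ≐ (X ⇝ₛ B i)

module _ (M : Model) where
  open Model M

  -- |M| : smallest set of sets of terms containing the 𝓑ᵢ, Rⱼ and closed
  -- under ⇝ (sets are compared extensionally)
  data InM : Pred Term 0ℓ → Set₁ where
    inB  : ∀ {i} → I i → InM (B i)
    inR  : ∀ {j} → J j → InM (R j)
    inArr : ∀ {K L} → InM K → InM L → InM (K ⇝ L)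
    inExt : ∀ {G H} → G ≐ H → InM G → InM H

  FormAt : Pred Term 0ℓ → ℕ → Set₁
  FormAt G i = Σ (Pred (List Term) 0ℓ) λ X → G ≐ (X ⇝ₛ B i)

  IsW : Pred Term 0ℓ → ℕ → Set₁
  IsW G i = I i × FormAt G i × (∀ j → I j → FormAt G j → i ≤ j)

  Perp : Pred Term 0ℓ → Pred (List Term) (lsuc 0ℓ)
  Perp G us = Σ ℕ λ i → IsW G i ×
              Σ (Pred (List Term) 0ℓ) λ X → G ≐ (X ⇝ₛ B i) × X us

  ⟦_⟧[_] : Ty → (ℕ → Pred Term 0ℓ) → Pred Term 0ℓ
  ⟦ var X ⟧[ ip ] = ip X
  ⟦ ⊥' ⟧[ ip ] = B 0
  ⟦ A ⇒ A' ⟧[ ip ] = ⟦ A ⟧[ ip ] ⇝ ⟦ A' ⟧[ ip ]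

ctxOf : ∀ {S : Set} → List (ℕ × Ty × S) → Ctx
ctxOf = map (λ { (x , A , _) → (x , A) })

subOf : List (ℕ × Ty × Term) → List (ℕ × Ty × List Term) → Sub
subOf Γs Δs = record { λpart = map (λ { (x , _ , u) → (x , u) }) Γs
                     ; μpart = map (λ { (α , _ , vs) → (α , vs) }) Δs }

module Submission where

-- The proof is by induction on the typing derivation, for a substitution
-- more general than the one of the statement: a μ-variable α may also be
-- RENAMED, (α w) becoming (β (w v̄)).  This is forced by the μ-rule: to show
-- (μα.t)σ v̄ ∈ 𝓑ᵢ we reduce it to μβ.(t σ') with a FRESH β ∈ 𝒞ᵢ and
-- σ' = σ, α ↦ (β , v̄), and conclude with the model axiom for μ.

open import Defs
open import Level using (0ℓ)
open import Data.Nat using (ℕ; suc; _≤_; _⊔_) renaming (_≟_ to _≟ℕ_)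
open import Data.Nat.Properties using (≤-trans; ≤-refl; ≤-antisym; m≤m⊔n; m≤n⊔m; n≤1+n; <⇒≢)
open import Data.Fin using (Fin; fromℕ; inject₁) renaming (zero to fz; suc to fs; _≟_ to _≟F_)
open import Data.Fin.Properties using (fromℕ≢inject₁)
open import Data.List using (List; []; _∷_; map)
open import Data.List.Relation.Unary.All as All using (All; []; _∷_)
open import Data.List.Relation.Unary.AllPairs using (_∷_)
open import Data.List.Relation.Unary.Unique.Propositional using (Unique)
open import Data.List.Relation.Unary.Any using (here; there)
open import Data.List.Membership.Propositional using (_∈_; _∉_)
open import Data.Maybe using (Maybe; just; nothing)
import Data.Maybe as Maybe
open import Data.Product using (Σ; _×_; _,_; proj₁; proj₂)
open import Data.Sum using (_⊎_; inj₁; inj₂)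
open import Data.Empty using (⊥-elim)
open import Relation.Nullary using (yes; no)
open import Relation.Unary using (Pred; _≐_; _⊆_)
open import Relation.Binary.PropositionalEquality
open import Relation.Binary.Construct.Closure.ReflexiveTransitive using (ε; _◅_)
import Relation.Binary.Construct.Closure.ReflexiveTransitive as Star

-- 1. Closed terms are inert under operations on bound variables

-- A closed term u
-- is placed under binders as wk0 u = ren (λ ()) (λ ()) u, so every fact
-- about wk0 below is the instance of a fact about ren.
ren : ∀ {k l n m} → (Fin k → Fin n) → (Fin l → Fin m) → Tm k l → Tm n m
ren a b t = renμ b (renλ a t)

extF-id : ∀ {n} {a : Fin n → Fin n} → a ≗ (λ i → i) → extF a ≗ (λ i → i)
extF-id ea fz = refl
extF-id ea (fs i) = cong fs (ea i)

extF-∘ : ∀ {k n n'} {a : Fin k → Fin n} {a' : Fin k → Fin n'} {ρ : Fin n → Fin n'} →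
  (∀ i → ρ (a i) ≡ a' i) → ∀ i → extF ρ (extF a i) ≡ extF a' i
extF-∘ e fz = refl
extF-∘ e (fs i) = cong fs (e i)

ren-id : ∀ {k l} {a : Fin k → Fin k} {b : Fin l → Fin l} →
  a ≗ (λ i → i) → b ≗ (λ i → i) → ∀ t → ren a b t ≡ t
ren-id ea eb (fvar x) = refl
ren-id ea eb (bvar i) = cong bvar (ea i)
ren-id ea eb (lam t) = cong lam (ren-id (extF-id ea) eb t)
ren-id ea eb (app t u) = cong₂ app (ren-id ea eb t) (ren-id ea eb u)
ren-id ea eb (mu t) = cong mu (ren-id ea (extF-id eb) t)
ren-id ea eb (fnm α t) = cong (fnm α) (ren-id ea eb t)
ren-id ea eb (bnm i t) = cong₂ bnm (eb i) (ren-id ea eb t)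

renλ-ren : ∀ {k l n n' m} {a : Fin k → Fin n} {a' : Fin k → Fin n'} {b : Fin l → Fin m}
  (ρ : Fin n → Fin n') → (∀ i → ρ (a i) ≡ a' i) → ∀ t → renλ ρ (ren a b t) ≡ ren a' b t
renλ-ren ρ e (fvar x) = refl
renλ-ren ρ e (bvar i) = cong bvar (e i)
renλ-ren ρ e (lam t) = cong lam (renλ-ren (extF ρ) (extF-∘ e) t)
renλ-ren ρ e (app t u) = cong₂ app (renλ-ren ρ e t) (renλ-ren ρ e u)
renλ-ren ρ e (mu t) = cong mu (renλ-ren ρ e t)
renλ-ren ρ e (fnm α t) = cong (fnm α) (renλ-ren ρ e t)
renλ-ren ρ e (bnm i t) = cong (bnm _) (renλ-ren ρ e t)

renμ-ren : ∀ {k l n m m'} {a : Fin k → Fin n} {b : Fin l → Fin m} {b' : Fin l → Fin m'}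
  (ρ : Fin m → Fin m') → (∀ i → ρ (b i) ≡ b' i) → ∀ t → renμ ρ (ren a b t) ≡ ren a b' t
renμ-ren ρ e (fvar x) = refl
renμ-ren ρ e (bvar i) = refl
renμ-ren ρ e (lam t) = cong lam (renμ-ren ρ e t)
renμ-ren ρ e (app t u) = cong₂ app (renμ-ren ρ e t) (renμ-ren ρ e u)
renμ-ren ρ e (mu t) = cong mu (renμ-ren (extF ρ) (extF-∘ e) t)
renμ-ren ρ e (fnm α t) = cong (fnm α) (renμ-ren ρ e t)
renμ-ren ρ e (bnm i t) = cong₂ bnm (e i) (renμ-ren ρ e t)

substλ-ren : ∀ {k l n n' m} {a : Fin k → Fin n} {a' : Fin k → Fin n'} {b : Fin l → Fin m}
  (s : Fin n → Tm n' m) → (∀ i → s (a i) ≡ bvar (a' i)) → ∀ t → substλ s (ren a b t) ≡ ren a' b t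
substλ-ren s e (fvar x) = refl
substλ-ren s e (bvar i) = e i
substλ-ren {a = a} {a'} s e (lam t) = cong lam (substλ-ren (extsλ s) e' t)
  where e' : ∀ i → extsλ s (extF a i) ≡ bvar (extF a' i)
        e' fz = refl
        e' (fs i) = cong (renλ fs) (e i)
substλ-ren s e (app t u) = cong₂ app (substλ-ren s e t) (substλ-ren s e u)
substλ-ren s e (mu t) = cong mu (substλ-ren (λ i → renμ fs (s i)) (λ i → cong (renμ fs) (e i)) t)
substλ-ren s e (fnm α t) = cong (fnm α) (substλ-ren s e t)
substλ-ren s e (bnm i t) = cong (bnm _) (substλ-ren s e t)

stμ-ren : ∀ {k l n m} {a : Fin k → Fin n} {b : Fin l → Fin m}
  (c : Fin m) (w : Tm n m) → (∀ i → c ≢ b i) → ∀ t → stμ c w (ren a b t) ≡ ren a b t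
stμ-ren c w e (fvar x) = refl
stμ-ren c w e (bvar i) = refl
stμ-ren c w e (lam t) = cong lam (stμ-ren c (renλ fs w) e t)
stμ-ren c w e (app t u) = cong₂ app (stμ-ren c w e t) (stμ-ren c w e u)
stμ-ren {b = b} c w e (mu t) = cong mu (stμ-ren (fs c) (renμ fs w) e' t)
  where e' : ∀ i → fs c ≢ extF b i
        e' fz ()
        e' (fs i) refl = e i refl
stμ-ren c w e (fnm α t) = cong (fnm α) (stμ-ren c w e t)
stμ-ren {b = b} c w e (bnm i t) with c ≟F b i
... | yes p = ⊥-elim (e i p)
... | no _ = cong (bnm _) (stμ-ren c w e t)

-- μsup t is a strict upper bound of the free μ-names of t
μsup : ∀ {n m} → Tm n m → ℕ
μsup (fvar x) = 0
μsup (bvar i) = 0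
μsup (lam t) = μsup t
μsup (app t u) = μsup t ⊔ μsup u
μsup (mu t) = μsup t
μsup (fnm γ t) = suc γ ⊔ μsup t
μsup (bnm a t) = μsup t

μsups : List Term → ℕ
μsups [] = 0
μsups (u ∷ us) = μsup u ⊔ μsups us

⊔≤ˡ : ∀ {x y z} → x ⊔ y ≤ z → x ≤ z
⊔≤ˡ {x} {y} p = ≤-trans (m≤m⊔n x y) p

⊔≤ʳ : ∀ {x y z} → x ⊔ y ≤ z → y ≤ z
⊔≤ʳ {x} {y} p = ≤-trans (m≤n⊔m x y) p

FreshBelow : ℕ → List Term → Set
FreshBelow k = All (λ v → μsup v ≤ k)

μsups-fresh : ∀ us {k} → μsups us ≤ k → FreshBelow k us
μsups-fresh [] p = []
μsups-fresh (u ∷ us) p = ⊔≤ˡ {μsup u} p ∷ μsups-fresh us (⊔≤ʳ {μsup u} p)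

fresh-weaken : ∀ {us k k'} → k ≤ k' → FreshBelow k us → FreshBelow k' us
fresh-weaken le = All.map (λ p → ≤-trans p le)

closeμ-ren : ∀ {k l n m} {a : Fin k → Fin n} {b : Fin l → Fin m} {b' : Fin l → Fin (suc m)}
  (ν : ℕ) → (∀ i → inject₁ (b i) ≡ b' i) → ∀ t → μsup t ≤ ν → closeμAt ν (ren a b t) ≡ ren a b' t
closeμ-ren ν e (fvar x) p = refl
closeμ-ren ν e (bvar i) p = refl
closeμ-ren ν e (lam t) p = cong lam (closeμ-ren ν e t p)
closeμ-ren ν e (app t u) p = cong₂ app (closeμ-ren ν e t (⊔≤ˡ p)) (closeμ-ren ν e u (⊔≤ʳ p))
closeμ-ren {b = b} {b'} ν e (mu t) p = cong mu (closeμ-ren ν e' t p)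
  where e' : ∀ i → inject₁ (extF b i) ≡ extF b' i
        e' fz = refl
        e' (fs i) = cong fs (e i)
closeμ-ren ν e (fnm γ t) p with ν ≟ℕ γ
... | yes refl = ⊥-elim (<⇒≢ (⊔≤ˡ {suc ν} {μsup t} p) refl)
... | no _ = cong (fnm γ) (closeμ-ren ν e t (⊔≤ʳ p))
closeμ-ren ν e (bnm i t) p = cong₂ bnm (e i) (closeμ-ren ν e t p)

wk0-id : (u : Term) → wk0 u ≡ u
wk0-id u = ren-id (λ ()) (λ ()) u

map-wk0-id : (vs : List Term) → map wk0 vs ≡ vs
map-wk0-id [] = refl
map-wk0-id (v ∷ vs) = cong₂ _∷_ (wk0-id v) (map-wk0-id vs)

renλ-wk0 : ∀ {n n' m} (ρ : Fin n → Fin n') (u : Term) → renλ {m = m} ρ (wk0 u) ≡ wk0 u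
renλ-wk0 ρ u = renλ-ren ρ (λ ()) u

renμ-wk0 : ∀ {n m m'} (ρ : Fin m → Fin m') (u : Term) → renμ {n = n} ρ (wk0 u) ≡ wk0 u
renμ-wk0 ρ u = renμ-ren ρ (λ ()) u

substλ-wk0 : ∀ {n n' m} (s : Fin n → Tm n' m) (u : Term) → substλ s (wk0 u) ≡ wk0 u
substλ-wk0 s u = substλ-ren s (λ ()) u

stμ-wk0 : ∀ {n m} c (w : Tm n m) (u : Term) → stμ c w (wk0 u) ≡ wk0 u
stμ-wk0 c w u = stμ-ren c w (λ ()) u

closeμ-wk0 : ∀ {n m} ν (u : Term) → μsup u ≤ ν → closeμAt {n} {m} ν (wk0 u) ≡ wk0 u
closeμ-wk0 ν u = closeμ-ren ν (λ ()) u

apps-hom : ∀ {n m n' m'} (h : Tm n m → Tm n' m') → (∀ x y → h (app x y) ≡ app (h x) (h y)) →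
  ∀ s ws → h (apps s ws) ≡ apps (h s) (map h ws)
apps-hom h e s [] = refl
apps-hom h e s (w ∷ ws) = trans (apps-hom h e (app s w) ws) (cong (λ z → apps z (map h ws)) (e s w))

apps-wk0 : ∀ {n m n' m'} (h : Tm n m → Tm n' m') → (∀ x y → h (app x y) ≡ app (h x) (h y)) →
  ∀ s vs → All (λ v → h (wk0 v) ≡ wk0 v) vs → h (apps s (map wk0 vs)) ≡ apps (h s) (map wk0 vs)
apps-wk0 h e s vs fixed = trans (apps-hom h e s (map wk0 vs)) (cong (apps (h s)) (map-fixed fixed))
  where map-fixed : ∀ {vs} → All (λ v → h (wk0 v) ≡ wk0 v) vs → map h (map wk0 vs) ≡ map wk0 vs
        map-fixed [] = refl
        map-fixed (p ∷ ps) = cong₂ _∷_ p (map-fixed ps)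

-- 2. Generalised substitution

-- The λ-part is a partial map from λ-names to closed terms; the μ-part
-- sends α to (β , v̄), meaning: replace every (α w) by (β (w v̄)).
λEnv : Set
λEnv = ℕ → Maybe Term

μEnv : Set
μEnv = ℕ → Maybe (ℕ × List Term)

substVar : ∀ {n m} → Maybe Term → ℕ → Tm n m
substVar (just u) x = wk0 u
substVar nothing x = fvar x

substName : ∀ {n m} → Maybe (ℕ × List Term) → ℕ → Tm n m → Tm n m
substName (just (δ , vs)) α s = fnm δ (apps s (map wk0 vs))
substName nothing α s = fnm α s

gsub : ∀ {n m} → λEnv → μEnv → Tm n m → Tm n m
gsub f g (fvar x) = substVar (f x) x
gsub f g (bvar i) = bvar i
gsub f g (lam t) = lam (gsub f g t)
gsub f g (app t u) = app (gsub f g t) (gsub f g u)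
gsub f g (mu t) = mu (gsub f g t)
gsub f g (fnm α t) = substName (g α) α (gsub f g t)
gsub f g (bnm a t) = bnm a (gsub f g t)

μEnvOf : List (ℕ × List Term) → μEnv
μEnvOf l α = Maybe.map (α ,_) (lookupL l α)

subAt-gsub : ∀ {n m} (σ : Sub) (t : Tm n m) →
  subAt σ t ≡ gsub (lookupL (Sub.λpart σ)) (μEnvOf (Sub.μpart σ)) t
subAt-gsub σ (fvar x) with lookupL (Sub.λpart σ) x
... | just u = refl
... | nothing = refl
subAt-gsub σ (bvar i) = refl
subAt-gsub σ (lam t) = cong lam (subAt-gsub σ t)
subAt-gsub σ (app t u) = cong₂ app (subAt-gsub σ t) (subAt-gsub σ u)
subAt-gsub σ (mu t) = cong mu (subAt-gsub σ t)
subAt-gsub σ (fnm α t) with lookupL (Sub.μpart σ) α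
... | just vs = cong (λ z → fnm α (apps z (map wk0 vs))) (subAt-gsub σ t)
... | nothing = cong (fnm α) (subAt-gsub σ t)
subAt-gsub σ (bnm a t) = cong (bnm a) (subAt-gsub σ t)

extendλ : λEnv → ℕ → Term → λEnv
extendλ f x v y with x ≟ℕ y
... | yes _ = just v
... | no _ = f y

extendμ : μEnv → ℕ → ℕ → List Term → μEnv
extendμ g α ν us γ with α ≟ℕ γ
... | yes _ = just (ν , us)
... | no _ = g γ

extendλ-here : ∀ f x v → extendλ f x v x ≡ just v
extendλ-here f x v with x ≟ℕ x
... | yes _ = refl
... | no x≢x = ⊥-elim (x≢x refl)

extendλ-there : ∀ f x v y → x ≢ y → extendλ f x v y ≡ f y
extendλ-there f x v y x≢y with x ≟ℕ y
... | yes x≡y = ⊥-elim (x≢y x≡y)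
... | no _ = refl

extendλ-cases : ∀ f x v y {u} → extendλ f x v y ≡ just u → (u ≡ v) ⊎ (f y ≡ just u)
extendλ-cases f x v y eq with x ≟ℕ y
extendλ-cases f x v y refl | yes _ = inj₁ refl
... | no _ = inj₂ eq

extendμ-here : ∀ g α ν us → extendμ g α ν us α ≡ just (ν , us)
extendμ-here g α ν us with α ≟ℕ α
... | yes _ = refl
... | no α≢α = ⊥-elim (α≢α refl)

extendμ-there : ∀ g α ν us γ → α ≢ γ → extendμ g α ν us γ ≡ g γ
extendμ-there g α ν us γ α≢γ with α ≟ℕ γ
... | yes α≡γ = ⊥-elim (α≢γ α≡γ)
... | no _ = refl

extendμ-cases : ∀ g α ν us γ {p} → extendμ g α ν us γ ≡ just p → (p ≡ (ν , us)) ⊎ (g γ ≡ just p)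
extendμ-cases g α ν us γ eq with α ≟ℕ γ
extendμ-cases g α ν us γ refl | yes _ = inj₁ refl
... | no _ = inj₂ eq

-- (λx.t)σ applied to v β-reduces to t(σ, x ↦ v): instantiating the bound
-- variable of the closed-off body equals substituting v for x.  Stated for
-- an arbitrary s instantiating the outermost bound variable (fromℕ n) by v
-- and fixing the others, so that it passes under binders.
gsub-closeλ : ∀ {n m} (f : λEnv) (g : μEnv) x v (s : Fin (suc n) → Tm n m) →
  s (fromℕ n) ≡ wk0 v → (∀ i → s (inject₁ i) ≡ bvar i) →
  ∀ t → substλ s (gsub f g (closeλAt x t)) ≡ gsub (extendλ f x v) g t
gsub-closeλ f g x v s s-top s-rest (fvar y) with x ≟ℕ y
... | yes refl = s-top
... | no _ with f y
...   | just u = substλ-wk0 s u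
...   | nothing = refl
gsub-closeλ f g x v s s-top s-rest (bvar i) = s-rest i
gsub-closeλ f g x v s s-top s-rest (lam t) =
  cong lam (gsub-closeλ f g x v (extsλ s) (trans (cong (renλ fs) s-top) (renλ-wk0 fs v)) s-rest' t)
  where s-rest' : ∀ i → extsλ s (inject₁ i) ≡ bvar i
        s-rest' fz = refl
        s-rest' (fs i) = cong (renλ fs) (s-rest i)
gsub-closeλ f g x v s s-top s-rest (app t u) =
  cong₂ app (gsub-closeλ f g x v s s-top s-rest t) (gsub-closeλ f g x v s s-top s-rest u)
gsub-closeλ f g x v s s-top s-rest (mu t) =
  cong mu (gsub-closeλ f g x v (λ i → renμ fs (s i)) (trans (cong (renμ fs) s-top) (renμ-wk0 fs v))
                       (λ i → cong (renμ fs) (s-rest i)) t)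
gsub-closeλ f g x v s s-top s-rest (fnm α t) with g α
... | just (δ , vs) = cong (fnm δ) (begin
        substλ s (apps (gsub f g (closeλAt x t)) (map wk0 vs))
          ≡⟨ apps-wk0 (substλ s) (λ _ _ → refl) _ vs (All.tabulate λ {v} _ → substλ-wk0 s v) ⟩
        apps (substλ s (gsub f g (closeλAt x t))) (map wk0 vs)
          ≡⟨ cong (λ z → apps z (map wk0 vs)) (gsub-closeλ f g x v s s-top s-rest t) ⟩
        apps (gsub (extendλ f x v) g t) (map wk0 vs) ∎)
  where open ≡-Reasoning
... | nothing = cong (fnm α) (gsub-closeλ f g x v s s-top s-rest t)
gsub-closeλ f g x v s s-top s-rest (bnm a t) = cong (bnm a) (gsub-closeλ f g x v s s-top s-rest t)

-- 3. The μ-reduction of (μα.t) v̄ and commutation with μα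

-- t[c :=* u₁][c :=* u₂]…: the body reached by reducing (μ.t) ū
stμs : ∀ {n m} → Fin m → List Term → Tm n m → Tm n m
stμs c [] s = s
stμs c (u ∷ us) s = stμs c us (stμ c (wk0 u) s)

apps-▷ : ∀ {n m} {t t' : Tm n m} us → t ▷ t' → apps t us ▷ apps t' us
apps-▷ [] r = r
apps-▷ (u ∷ us) r = apps-▷ us (c-appl r)

apps-mu : ∀ (s : Tm 0 1) us → apps (mu s) us ▷* mu (stμs fz us s)
apps-mu s [] = ε
apps-mu s (u ∷ us) = apps-▷ us step ◅ apps-mu (stμ fz (wk0 u) s) us
  where
    renμ-closed : renμ fs u ≡ wk0 u
    renμ-closed = trans (cong (renμ fs) (sym (wk0-id u))) (renμ-wk0 fs u)
    step : app (mu s) u ▷ mu (stμ fz (wk0 u) s)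
    step = subst (λ z → app (mu s) u ▷ mu (stμ fz z s)) renμ-closed (μred s u)

stμs-fvar : ∀ {n m} c us x → stμs {n} {m} c us (fvar x) ≡ fvar x
stμs-fvar c [] x = refl
stμs-fvar c (u ∷ us) x = stμs-fvar c us x

stμs-bvar : ∀ {n m} c us (i : Fin n) → stμs {n} {m} c us (bvar i) ≡ bvar i
stμs-bvar c [] i = refl
stμs-bvar c (u ∷ us) i = stμs-bvar c us i

stμs-lam : ∀ {n m} c us (s : Tm (suc n) m) → stμs c us (lam s) ≡ lam (stμs c us s)
stμs-lam c [] s = refl
stμs-lam c (u ∷ us) s =
  trans (cong (λ z → stμs c us (lam (stμ c z s))) (renλ-wk0 fs u)) (stμs-lam c us _)

stμs-app : ∀ {n m} c us (s t : Tm n m) → stμs c us (app s t) ≡ app (stμs c us s) (stμs c us t)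
stμs-app c [] s t = refl
stμs-app c (u ∷ us) s t = stμs-app c us _ _

stμs-mu : ∀ {n m} c us (s : Tm n (suc m)) → stμs c us (mu s) ≡ mu (stμs (fs c) us s)
stμs-mu c [] s = refl
stμs-mu c (u ∷ us) s =
  trans (cong (λ z → stμs c us (mu (stμ (fs c) z s))) (renμ-wk0 fs u)) (stμs-mu c us _)

stμs-fnm : ∀ {n m} c us γ (s : Tm n m) → stμs c us (fnm γ s) ≡ fnm γ (stμs c us s)
stμs-fnm c [] γ s = refl
stμs-fnm c (u ∷ us) γ s = stμs-fnm c us γ _

stμs-bnm-other : ∀ {n m} c us b (s : Tm n m) → c ≢ b → stμs c us (bnm b s) ≡ bnm b (stμs c us s)
stμs-bnm-other c [] b s c≢b = refl
stμs-bnm-other c (u ∷ us) b s c≢b with c ≟F b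
... | yes c≡b = ⊥-elim (c≢b c≡b)
... | no _ = stμs-bnm-other c us b _ c≢b

stμs-wk0 : ∀ {n m} c us (u : Term) → stμs {n} {m} c us (wk0 u) ≡ wk0 u
stμs-wk0 c [] u = refl
stμs-wk0 c (v ∷ us) u = trans (cong (stμs c us) (stμ-wk0 c (wk0 v) u)) (stμs-wk0 c us u)

stμs-bnm-self : ∀ {n m} c us (s : Tm n m) → stμs c us (bnm c s) ≡ bnm c (apps (stμs c us s) (map wk0 us))
stμs-bnm-self c [] s = refl
stμs-bnm-self c (u ∷ us) s with c ≟F c
... | no c≢c = ⊥-elim (c≢c refl)
... | yes _ = begin
  stμs c us (bnm c (app (stμ c (wk0 u) s) (wk0 u)))
    ≡⟨ stμs-bnm-self c us _ ⟩
  bnm c (apps (stμs c us (app (stμ c (wk0 u) s) (wk0 u))) (map wk0 us))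
    ≡⟨ cong (λ z → bnm c (apps z (map wk0 us))) (stμs-app c us _ _) ⟩
  bnm c (apps (app (stμs c us (stμ c (wk0 u) s)) (stμs c us (wk0 u))) (map wk0 us))
    ≡⟨ cong (λ z → bnm c (apps (app (stμs c us (stμ c (wk0 u) s)) z) (map wk0 us))) (stμs-wk0 c us u) ⟩
  bnm c (apps (app (stμs c us (stμ c (wk0 u) s)) (wk0 u)) (map wk0 us)) ∎
  where open ≡-Reasoning

stμs-apps-wk0 : ∀ {n m} c us (s : Tm n m) vs →
  stμs c us (apps s (map wk0 vs)) ≡ apps (stμs c us s) (map wk0 vs)
stμs-apps-wk0 c us s vs = apps-wk0 (stμs c us) (stμs-app c us) s vs (All.tabulate λ {v} _ → stμs-wk0 c us v)

closeμ-apps-wk0 : ∀ {n m} ν (s : Tm n m) vs → FreshBelow ν vs →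
  closeμAt ν (apps s (map wk0 vs)) ≡ apps (closeμAt ν s) (map wk0 vs)
closeμ-apps-wk0 ν s vs fresh = apps-wk0 (closeμAt ν) (λ _ _ → refl) s vs (All.map (closeμ-wk0 ν _) fresh)

closeμ-self : ∀ {n m} x (s : Tm n m) → closeμAt x (fnm x s) ≡ bnm (fromℕ m) (closeμAt x s)
closeμ-self x s with x ≟ℕ x
... | yes _ = refl
... | no x≢x = ⊥-elim (x≢x refl)

closeμ-other : ∀ {n m} x y (s : Tm n m) → x ≢ y → closeμAt x (fnm y s) ≡ fnm y (closeμAt x s)
closeμ-other x y s x≢y with x ≟ℕ y
... | yes x≡y = ⊥-elim (x≢y x≡y)
... | no _ = refl

record FreshEnv (N : ℕ) (f : λEnv) (g : μEnv) : Set where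
  field
    λ-fresh : ∀ x u → f x ≡ just u → μsup u ≤ N
    μ-fresh : ∀ γ δ vs → g γ ≡ just (δ , vs) → suc δ ≤ N × FreshBelow N vs

freshEnv-weaken : ∀ {N N' f g} → N ≤ N' → FreshEnv N f g → FreshEnv N' f g
FreshEnv.λ-fresh (freshEnv-weaken le F) x u e = ≤-trans (FreshEnv.λ-fresh F x u e) le
FreshEnv.μ-fresh (freshEnv-weaken le F) γ δ vs e with FreshEnv.μ-fresh F γ δ vs e
... | δ<N , vs-fresh = ≤-trans δ<N le , fresh-weaken le vs-fresh

-- Reducing (μα.t)σ ū gives μ.(t'[top :=* ū]) with t' = (closed-off t)σ;
-- for ν fresh w.r.t. t and σ this body is t(σ, α ↦ (ν , ū)) with ν
-- closed off.  Stated for the outermost μ-index fromℕ m to pass under binders.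
gsub-closeμ : ∀ {n m} (f : λEnv) (g : μEnv) α ν us →
  FreshEnv ν f g → FreshBelow ν us → ∀ (t : Tm n m) → μsup t ≤ ν →
  stμs (fromℕ m) us (gsub f g (closeμAt α t)) ≡ closeμAt ν (gsub f (extendμ g α ν us) t)
gsub-closeμ f g α ν us F us-fresh (fvar x) p with f x in eq
... | just u = trans (stμs-wk0 _ us u) (sym (closeμ-wk0 ν u (FreshEnv.λ-fresh F x u eq)))
... | nothing = stμs-fvar _ us x
gsub-closeμ f g α ν us F us-fresh (bvar i) p = stμs-bvar _ us i
gsub-closeμ f g α ν us F us-fresh (lam t) p =
  trans (stμs-lam _ us _) (cong lam (gsub-closeμ f g α ν us F us-fresh t p))
gsub-closeμ f g α ν us F us-fresh (app t u) p = trans (stμs-app _ us _ _)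
  (cong₂ app (gsub-closeμ f g α ν us F us-fresh t (⊔≤ˡ p)) (gsub-closeμ f g α ν us F us-fresh u (⊔≤ʳ {μsup t} p)))
gsub-closeμ f g α ν us F us-fresh (mu t) p =
  trans (stμs-mu _ us _) (cong mu (gsub-closeμ f g α ν us F us-fresh t p))
gsub-closeμ {n} {m} f g α ν us F us-fresh (fnm γ t) p with α ≟ℕ γ
... | yes refl = begin
  stμs (fromℕ m) us (bnm (fromℕ m) (gsub f g (closeμAt α t)))
    ≡⟨ stμs-bnm-self (fromℕ m) us _ ⟩
  bnm (fromℕ m) (apps (stμs (fromℕ m) us (gsub f g (closeμAt α t))) (map wk0 us))
    ≡⟨ cong (λ z → bnm (fromℕ m) (apps z (map wk0 us))) (gsub-closeμ f g α ν us F us-fresh t (⊔≤ʳ {suc α} p)) ⟩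
  bnm (fromℕ m) (apps (closeμAt ν t') (map wk0 us))
    ≡⟨ cong (bnm (fromℕ m)) (sym (closeμ-apps-wk0 ν t' us us-fresh)) ⟩
  bnm (fromℕ m) (closeμAt ν (apps t' (map wk0 us)))
    ≡⟨ sym (closeμ-self ν _) ⟩
  closeμAt ν (fnm ν (apps t' (map wk0 us))) ∎
  where open ≡-Reasoning
        t' : Tm n m
        t' = gsub f (extendμ g α ν us) t
... | no _ with g γ in eq
...   | just (δ , vs) = begin
  stμs (fromℕ m) us (fnm δ (apps (gsub f g (closeμAt α t)) (map wk0 vs)))
    ≡⟨ stμs-fnm (fromℕ m) us δ _ ⟩
  fnm δ (stμs (fromℕ m) us (apps (gsub f g (closeμAt α t)) (map wk0 vs)))
    ≡⟨ cong (fnm δ) (stμs-apps-wk0 (fromℕ m) us _ vs) ⟩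
  fnm δ (apps (stμs (fromℕ m) us (gsub f g (closeμAt α t))) (map wk0 vs))
    ≡⟨ cong (λ z → fnm δ (apps z (map wk0 vs))) (gsub-closeμ f g α ν us F us-fresh t (⊔≤ʳ {suc γ} p)) ⟩
  fnm δ (apps (closeμAt ν t') (map wk0 vs))
    ≡⟨ cong (fnm δ) (sym (closeμ-apps-wk0 ν t' vs vs-fresh)) ⟩
  fnm δ (closeμAt ν (apps t' (map wk0 vs)))
    ≡⟨ sym (closeμ-other ν δ _ (λ ν≡δ → <⇒≢ δ<ν (sym ν≡δ))) ⟩
  closeμAt ν (fnm δ (apps t' (map wk0 vs))) ∎
  where open ≡-Reasoning
        t' : Tm n m
        t' = gsub f (extendμ g α ν us) t
        δ<ν : suc δ ≤ ν
        δ<ν = proj₁ (FreshEnv.μ-fresh F γ δ vs eq)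
        vs-fresh : FreshBelow ν vs
        vs-fresh = proj₂ (FreshEnv.μ-fresh F γ δ vs eq)
...   | nothing = trans (stμs-fnm (fromℕ m) us γ _) (trans
          (cong (fnm γ) (gsub-closeμ f g α ν us F us-fresh t (⊔≤ʳ {suc γ} p)))
          (sym (closeμ-other ν γ _ (λ ν≡γ → <⇒≢ (⊔≤ˡ {suc γ} {μsup t} p) (sym ν≡γ)))))
gsub-closeμ {m = m} f g α ν us F us-fresh (bnm b t) p =
  trans (stμs-bnm-other (fromℕ m) us (inject₁ b) _ fromℕ≢inject₁)
        (cong (bnm (inject₁ b)) (gsub-closeμ f g α ν us F us-fresh t p))

-- 4. Elements of |𝓜|

module _ (M : Model) where
  open Model M

  HasForm : Pred Term 0ℓ → Set₁
  HasForm G = Σ ℕ λ i → I i × FormAt M G i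

  -- every element of |𝓜| has this form: 𝓑ᵢ = {[]} ⇝ 𝓑ᵢ, Rⱼ by the model
  -- axiom, and K ⇝ (X ⇝ 𝓑ᵢ) = (K · X) ⇝ 𝓑ᵢ
  inM-form : ∀ {G} → InM M G → HasForm G
  inM-form (inB {i} Ii) = i , Ii , (λ us → us ≡ []) , (λ bt → λ { .[] refl → bt }) , (λ h → h [] refl)
  inM-form (inR {j} Jj) = R-form j Jj
  inM-form {G} (inArr {K} {L} _ l) with inM-form l
  ... | i , Ii , X , to , from = i , Ii , K∷X , to' , from'
    where
      K∷X : Pred (List Term) 0ℓ
      K∷X us = Σ Term λ u → Σ (List Term) λ us' → us ≡ u ∷ us' × K u × X us'
      to' : G ⊆ (K∷X ⇝ₛ B i)
      to' h .(u ∷ us') (u , us' , refl , ku , xus) = to (h u ku) us' xus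
      from' : (K∷X ⇝ₛ B i) ⊆ G
      from' h u ku = from (λ us' xus → h (u ∷ us') (u , us' , refl , ku , xus))
  inM-form (inExt (p , q) g) with inM-form g
  ... | i , Ii , X , to , from = i , Ii , X , (λ h → to (q h)) , (λ h → p (from h))

  inM-saturated : ∀ {G} → InM M G → Saturated G
  inM-saturated (inB Ii) = B-saturated _ Ii
  inM-saturated (inR Jj) = R-saturated _ Jj
  inM-saturated (inArr k l) v u v▷*u h w kw =
    inM-saturated l _ _ (Star.gmap (λ z → app z w) c-appl v▷*u) (h w kw)
  inM-saturated (inExt (p , q) g) v u v▷*u h = p (inM-saturated g v u v▷*u (q h))

-- 5. Soundness for the generalised substitution

mem-dom : ∀ {x A} {Γ : Ctx} → (x , A) ∈ Γ → x ∈ dom Γ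
mem-dom (here refl) = here refl
mem-dom (there m) = there (mem-dom m)

fresh-name : ∀ {x y A} {Γ : Ctx} → x ∉ dom Γ → (y , A) ∈ Γ → x ≢ y
fresh-name x∉Γ m refl = x∉Γ (mem-dom m)

module Soundness (M : Model) (ip : ℕ → Pred Term 0ℓ) (ipM : ∀ X → InM M (ip X)) where
  open Model M

  ⟦_⟧ : Ty → Pred Term 0ℓ
  ⟦ A ⟧ = ⟦_⟧[_] M A ip

  ⟦⟧-inM : ∀ A → InM M ⟦ A ⟧
  ⟦⟧-inM (var X) = ipM X
  ⟦⟧-inM ⊥' = inB 0∈I
  ⟦⟧-inM (A ⇒ A') = inArr (⟦⟧-inM A) (⟦⟧-inM A')

  record Realises (f : λEnv) (g : μEnv) (N : ℕ) (Γ Δ : Ctx) : Set₁ where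
    field
      λ-real : ∀ {x A} → (x , A) ∈ Γ → Σ Term λ u → f x ≡ just u × ⟦ A ⟧ u
      μ-real : ∀ {α A} → (α , A) ∈ Δ → Σ ℕ λ ν → Σ (List Term) λ vs → g α ≡ just (ν , vs) ×
                 Σ ℕ λ i → I i × Σ (Pred (List Term) 0ℓ) λ X → (⟦ A ⟧ ≐ (X ⇝ₛ B i)) × X vs × C i ν
      fresh : FreshEnv N f g
  open Realises

  soundness : ∀ {Γ Δ t A} → Γ ⊢ t ∶ A ∣ Δ → ∀ f g N → Realises f g N Γ Δ → ⟦ A ⟧ (gsub f g t)
  soundness (ax {x} {A} x∈Γ) f g N R with λ-real R x∈Γ
  ... | u , eq , ⟦A⟧u rewrite eq = subst ⟦ A ⟧ (sym (wk0-id u)) ⟦A⟧u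
  soundness (→e d₁ d₂) f g N R = soundness d₁ f g N R _ (soundness d₂ f g N R)
  -- (λx.t)σ v ▷ t(σ, x ↦ v), which realises B by induction
  soundness {Γ} {Δ} (→i {x} {A} {B} {t} x∉Γ d) f g N R v ⟦A⟧v =
    inM-saturated M (⟦⟧-inM B) _ _ (β _ v ◅ ε) (subst ⟦ B ⟧ (sym body) (soundness d f' g N' R'))
    where
      f' : λEnv
      f' = extendλ f x v
      N' : ℕ
      N' = N ⊔ μsup v
      body : inst (gsub f g (closeλAt x t)) v ≡ gsub f' g t
      body = gsub-closeλ f g x v _ (sym (wk0-id v)) (λ ()) t
      R' : Realises f' g N' ((x , A) ∷ Γ) Δ
      λ-real R' (here refl) = v , extendλ-here f x v , ⟦A⟧v
      λ-real R' {y} (there y∈Γ) with λ-real R y∈Γ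
      ... | u , eq , ⟦⟧u = u , trans (extendλ-there f x v y (fresh-name x∉Γ y∈Γ)) eq , ⟦⟧u
      μ-real R' = μ-real R
      FreshEnv.λ-fresh (fresh R') y u eq with extendλ-cases f x v y eq
      ... | inj₁ refl = m≤n⊔m N (μsup v)
      ... | inj₂ e = ≤-trans (FreshEnv.λ-fresh (fresh R) y u e) (m≤m⊔n N (μsup v))
      FreshEnv.μ-fresh (fresh R') = FreshEnv.μ-fresh (freshEnv-weaken (m≤m⊔n N (μsup v)) (fresh R))
  -- writing ⟦A⟧ = X ⇝ 𝓑ᵢ: for ū ∈ X, (μα.t)σ ū ▷* μν.(t(σ, α ↦ (ν , ū)))
  -- with ν ∈ 𝒞ᵢ fresh, and the body is in 𝓑₀ by induction
  soundness {Γ} {Δ} (μi {α} {A} {t} α∉Δ d) f g N R with inM-form M (⟦⟧-inM A)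
  ... | i , Ii , X , to , from = from realises
    where
      realises : (X ⇝ₛ B i) (gsub f g (Mu α t))
      realises us us∈X with C-infinite i Ii (N ⊔ μsup t ⊔ μsups us)
      ... | ν , le , ν∈Cᵢ =
        B-saturated i Ii _ _ (apps-mu _ us)
          (subst (B i) (sym (cong mu body)) (mu-B i Ii ν ν∈Cᵢ _ (soundness d f g' (suc ν) R')))
        where
          N≤ν : N ≤ ν
          N≤ν = ⊔≤ˡ {N} (⊔≤ˡ {N ⊔ μsup t} le)
          us-fresh : FreshBelow ν us
          us-fresh = μsups-fresh us (⊔≤ʳ {N ⊔ μsup t} le)
          g' : μEnv
          g' = extendμ g α ν us
          body : stμs fz us (gsub f g (closeμAt α t)) ≡ closeμAt ν (gsub f g' t)
          body = gsub-closeμ f g α ν us (freshEnv-weaken N≤ν (fresh R)) us-fresh t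
                   (⊔≤ʳ {N} (⊔≤ˡ {N ⊔ μsup t} le))
          R' : Realises f g' (suc ν) Γ ((α , A) ∷ Δ)
          λ-real R' = λ-real R
          μ-real R' (here refl) = ν , us , extendμ-here g α ν us , i , Ii , X , (to , from) , us∈X , ν∈Cᵢ
          μ-real R' {γ} (there γ∈Δ) with μ-real R γ∈Δ
          ... | ν' , vs , eq , rest = ν' , vs , trans (extendμ-there g α ν us γ (fresh-name α∉Δ γ∈Δ)) eq , rest
          FreshEnv.λ-fresh (fresh R') = FreshEnv.λ-fresh (freshEnv-weaken (≤-trans N≤ν (n≤1+n ν)) (fresh R))
          FreshEnv.μ-fresh (fresh R') γ δ vs eq with extendμ-cases g α ν us γ eq
          ... | inj₁ refl = ≤-refl , fresh-weaken (n≤1+n ν) us-fresh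
          ... | inj₂ e = FreshEnv.μ-fresh (freshEnv-weaken (≤-trans N≤ν (n≤1+n ν)) (fresh R)) γ δ vs e
  -- (α t)σ = (ν (tσ v̄)) with tσ v̄ ∈ 𝓑ᵢ and ν ∈ 𝒞ᵢ
  soundness (⊥i {α} {A} {t} α∈Δ d) f g N R with μ-real R α∈Δ
  ... | ν , vs , eq , i , Ii , X , (to , _) , vs∈X , ν∈Cᵢ rewrite eq | map-wk0-id vs =
    name-B i Ii ν ν∈Cᵢ _ (to (soundness d f g N R) vs vs∈X)

-- 6. The substitution of the statement, and the theorem

maxOver : ∀ {S : Set} → (ℕ → S → ℕ) → List (ℕ × S) → ℕ
maxOver h [] = 0
maxOver h ((x , a) ∷ l) = h x a ⊔ maxOver h l

lookupL-≤max : ∀ {S : Set} (h : ℕ → S → ℕ) l x {a} → lookupL l x ≡ just a → h x a ≤ maxOver h l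
lookupL-≤max h ((y , b) ∷ l) x eq with x ≟ℕ y | eq
... | yes refl | refl = m≤m⊔n (h y b) (maxOver h l)
... | no _ | eq' = ≤-trans (lookupL-≤max h l x eq') (m≤n⊔m (h y b) (maxOver h l))

σbound : Sub → ℕ
σbound σ = maxOver (λ _ u → μsup u) (Sub.λpart σ) ⊔ maxOver (λ α vs → suc α ⊔ μsups vs) (Sub.μpart σ)

freshEnv-σ : ∀ σ → FreshEnv (σbound σ) (lookupL (Sub.λpart σ)) (μEnvOf (Sub.μpart σ))
FreshEnv.λ-fresh (freshEnv-σ σ) x u eq =
  ≤-trans (lookupL-≤max (λ _ u → μsup u) (Sub.λpart σ) x eq) (m≤m⊔n _ _)
FreshEnv.μ-fresh (freshEnv-σ σ) γ δ vs e with lookupL (Sub.μpart σ) γ in eq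
FreshEnv.μ-fresh (freshEnv-σ σ) γ .γ vs refl | just .vs =
  ≤-trans (⊔≤ˡ {suc γ} {μsups vs} le) (m≤n⊔m _ _) ,
  fresh-weaken (m≤n⊔m _ _) (μsups-fresh vs (⊔≤ʳ {suc γ} le))
  where le : suc γ ⊔ μsups vs ≤ maxOver (λ α vs → suc α ⊔ μsups vs) (Sub.μpart σ)
        le = lookupL-≤max (λ α vs → suc α ⊔ μsups vs) (Sub.μpart σ) γ eq

mem-keys : ∀ {S : Set} {x A} (l : List (ℕ × Ty × S)) → (x , A) ∈ ctxOf l → x ∈ map proj₁ l
mem-keys (e ∷ l) (here refl) = here refl
mem-keys (e ∷ l) (there m) = there (mem-keys l m)

lookup-declared : ∀ {S : Set} (p : ℕ × Ty × S → ℕ × S) → (∀ x A s → p (x , A , s) ≡ (x , s)) →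
  ∀ l → Unique (map proj₁ l) → ∀ {x A} → (x , A) ∈ ctxOf l →
  Σ S λ s → lookupL (map p l) x ≡ just s × (x , A , s) ∈ l
lookup-declared p p-pair ((y , B , s) ∷ l) (y∉l ∷ unique) {x} x∈ rewrite p-pair y B s with x ≟ℕ y | x∈
... | yes refl | here refl = s , refl , here refl
... | yes refl | there x∈l = ⊥-elim (All.lookup y∉l (mem-keys l x∈l) refl)
... | no x≢y | here refl = ⊥-elim (x≢y refl)
... | no _ | there x∈l with lookup-declared p p-pair l unique x∈l
...   | s' , eq , m = s' , eq , there m

module _ (M : Model) (ip : ℕ → Pred Term 0ℓ) (ipM : ∀ X → InM M (ip X)) where
  open Model M
  open Soundness M ip ipM

  realises-σ : ∀ Γs Δs → Unique (map proj₁ Γs) → Unique (map proj₁ Δs) →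
    All (λ { (α , B , vs) → Σ ℕ λ i → IsW M ⟦ B ⟧ i × C i α }) Δs →
    All (λ { (x , A , u) → ⟦ A ⟧ u }) Γs →
    All (λ { (α , B , vs) → Perp M ⟦ B ⟧ vs }) Δs →
    Realises (lookupL (Sub.λpart (subOf Γs Δs))) (μEnvOf (Sub.μpart (subOf Γs Δs)))
             (σbound (subOf Γs Δs)) (ctxOf Γs) (ctxOf Δs)
  Realises.λ-real (realises-σ Γs Δs uΓ uΔ hw hΓ hΔ) x∈Γ
    with lookup-declared _ (λ _ _ _ → refl) Γs uΓ x∈Γ
  ... | u , eq , m = u , eq , All.lookup hΓ m
  Realises.μ-real (realises-σ Γs Δs uΓ uΔ hw hΓ hΔ) {α} α∈Δ
    with lookup-declared _ (λ _ _ _ → refl) Δs uΔ α∈Δ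
  ... | vs , eq , m with All.lookup hw m | All.lookup hΔ m
  ...   | i , (Ii , Fi , i-min) , α∈Cᵢ | i' , (Ii' , Fi' , i'-min) , X , ⟦⟧≐ , vs∈X
    -- i and i' are both w(⟦B⟧), hence equal
    rewrite ≤-antisym (i-min i' Ii' (X , ⟦⟧≐)) (i'-min i Ii Fi) =
    α , vs , cong (Maybe.map (α ,_)) eq , i' , Ii' , X , ⟦⟧≐ , vs∈X , α∈Cᵢ
  Realises.fresh (realises-σ Γs Δs uΓ uΔ hw hΓ hΔ) = freshEnv-σ (subOf Γs Δs)

lemma2p18 : (M : Model) (ip : ℕ → Pred Term 0ℓ) → (∀ X → InM M (ip X)) →
    (Γs : List (ℕ × Ty × Term)) (Δs : List (ℕ × Ty × List Term)) →
    Unique (map proj₁ Γs) → Unique (map proj₁ Δs) →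
    All (λ { (α , B , vs) → Σ ℕ λ i → IsW M (⟦_⟧[_] M B ip) i × Model.C M i α }) Δs →
    All (λ { (x , A , u) → ⟦_⟧[_] M A ip u }) Γs →
    All (λ { (α , B , vs) → Perp M (⟦_⟧[_] M B ip) vs }) Δs →
    ∀ u A → ctxOf Γs ⊢ u ∶ A ∣ ctxOf Δs →
    ⟦_⟧[_] M A ip (u ⟨ subOf Γs Δs ⟩)
lemma2p18 M ip ipM Γs Δs uΓ uΔ hw hΓ hΔ u A d =
  subst ⟦ A ⟧ (sym (subAt-gsub (subOf Γs Δs) u))
    (soundness d _ _ _ (realises-σ M ip ipM Γs Δs uΓ uΔ hw hΓ hΔ))
  where open Soundness M ip ipM
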